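{- Let $(t_n)_{n\ge0}$ be the Thue–Morse sequence. Let $L_J$ be the set of binary words $w_{m-1}\cdots w_0$ (leading zeroes allowed) such that there is no index $i\in\{0,\dots,m-2\}$ with $w_{i+1}=1$, $w_i=0$ and $t_i=0$; let $u_n$ be the number of words of length $n$ in $L_J$; let $L_J'$ be the set of words of $L_J$ not starting with $0$; and let $(v_n)_{n\ge0}$ be the characteristic sequence of $L_J'$ in base $2$, i.e., $v_n=1$ if $\mathrm{rep}_2(n)\in L_J'$ and $v_n=0$ otherwise. Then neither $(u_n)_{n\ge0}$ nor $(v_n)_{n\ge0}$ is $2$-regular.
   Context: The Thue–Morse sequence is defined by $t_n=$ (number of $1$'s in the binary expansion of $n$) mod $2$. $\mathrm{rep}_2(n)$ is the binary representation of $n$ (most significant digit first, no leading zeroes; $\mathrm{rep}_2(0)$ is the empty word). A sequence $(s_n)_{n\ge0}$ is $b$-regular if there exist a row vector $V$, a column vector $W$ and square matrices $M_0,\dots,M_{b-1}$ (over $\mathbb{Q}$) such that $s_n=VM_{w_k}\cdots M_{w_0}W$ for all $n\ge0$, where $\mathrm{rep}_b(n)=w_k\cdots w_0$. -}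

module Defs where

open import Data.Bool using (Bool; true; false; not; _∧_; _xor_)
open import Data.Nat using (ℕ; zero; suc; _≡ᵇ_)
open import Data.Nat.DivMod using (_/_; _%_)
open import Data.List using (List; []; _∷_; map; _++_; length; filterᵇ; foldr)
open import Data.Fin using (Fin; zero; suc)
open import Data.Product using (Σ)
open import Data.Integer using (+_)
open import Data.Rational using (ℚ; 0ℚ; 1ℚ) renaming (_/_ to _/ℚ_)
import Data.Rational as Q
open import Relation.Binary.PropositionalEquality using (_≡_)

-- CONVENTION: a binary word w_{m-1} ⋯ w_0 is represented as the list
-- w_0 ∷ w_1 ∷ ⋯ ∷ w_{m-1} ∷ [] (least significant digit FIRST),
-- with true = digit 1 and false = digit 0.

-- binary digits of n, least significant first, no leading zeroes;
-- bits 0 = [] (rep₂(0) is the empty word).  The first argument is fuel.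
bitsAux : ℕ → ℕ → List Bool
bitsAux zero    _       = []
bitsAux (suc f) zero    = []
bitsAux (suc f) (suc k) = ((suc k % 2) ≡ᵇ 1) ∷ bitsAux f (suc k / 2)

rep2 : ℕ → List Bool
rep2 n = bitsAux n n

thueMorse : ℕ → Bool
thueMorse n = foldr _xor_ false (rep2 n)

-- okFrom i (w_i ∷ w_{i+1} ∷ …): no j ≥ i with w_{j+1}=1, w_j=0, t_j=0
okFrom : ℕ → List Bool → Bool
okFrom i (a ∷ b ∷ rest) = not (b ∧ not a ∧ not (thueMorse i)) ∧ okFrom (suc i) (b ∷ rest)
okFrom i _              = true

inLJ : List Bool → Bool
inLJ w = okFrom 0 w

-- the word starts with 0 (its most significant = last listed letter is 0)
startsWith0 : List Bool → Bool
startsWith0 []           = false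
startsWith0 (a ∷ [])     = not a
startsWith0 (a ∷ b ∷ bs) = startsWith0 (b ∷ bs)

inLJ' : List Bool → Bool
inLJ' w = inLJ w ∧ not (startsWith0 w)

allWords : ℕ → List (List Bool)
allWords zero    = [] ∷ []
allWords (suc n) = map (false ∷_) (allWords n) ++ map (true ∷_) (allWords n)

u : ℕ → ℕ
u n = length (filterᵇ inLJ (allWords n))

v : ℕ → ℕ
v n with inLJ' (rep2 n)
... | true  = 1
... | false = 0

toℚ : ℕ → ℚ
toℚ n = + n /ℚ 1

sumFin : (d : ℕ) → (Fin d → ℚ) → ℚ
sumFin zero    f = 0ℚ
sumFin (suc d) f = f zero Q.+ sumFin d (λ i → f (suc i))

Matrix : ℕ → Set
Matrix d = Fin d → Fin d → ℚ

identity : (d : ℕ) → Matrix d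
identity zero    ()
identity (suc d) zero    zero    = 1ℚ
identity (suc d) zero    (suc j) = 0ℚ
identity (suc d) (suc i) zero    = 0ℚ
identity (suc d) (suc i) (suc j) = identity d i j

mul : (d : ℕ) → Matrix d → Matrix d → Matrix d
mul d A B i j = sumFin d (λ k → A i k Q.* B k j)

-- for the word w_0 ∷ … ∷ w_k (rep₂ reversed) this is M_{w_k} ⋯ M_{w_0}
prodWord : (d : ℕ) → (Bool → Matrix d) → List Bool → Matrix d
prodWord d M []       = identity d
prodWord d M (b ∷ bs) = mul d (prodWord d M bs) (M b)

bilinear : (d : ℕ) → (Fin d → ℚ) → Matrix d → (Fin d → ℚ) → ℚ
bilinear d V P W = sumFin d (λ i → sumFin d (λ j → V i Q.* (P i j Q.* W j)))

record Regular2 (s : ℕ → ℚ) : Set where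
  field
    dim : ℕ
    V   : Fin dim → ℚ
    W   : Fin dim → ℚ
    M   : Bool → Matrix dim
    rep : ∀ n → s n ≡ bilinear dim V (prodWord dim M (rep2 n)) W

module Submission where

-- u: the entries of a product of k matrices grow at most like K^k, so a 2-regular
-- sequence is O(C · K^(log₂ n)), i.e. polynomially bounded.  But u grows
-- exponentially: of t_{2k} and t_{2k+1} exactly one is 1, and at a position i with
-- t_i = 1 both letters are allowed, so each pair of positions at least doubles the
-- count and u(2m) ≥ 2^m.
--
-- v: the word 1 0^(N+1) lies in L_J' exactly when t_N = 1, and t(2^j + 2^i) = [i = j]
-- for i ≤ j.  Cutting 1 0^(2^i + 2^j + 1) into the prefix 1 0^(2^i) and the suffix
-- 0^(2^j + 1) writes v of it as a_i · b_j, with a_i = V · M(prefix) and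
-- b_j = M(suffix) · W in ℚ^d.  So a_i · b_i ≠ 0 and a_i · b_j = 0 for i < j, an
-- infinite triangular system, which Gaussian elimination rules out in dimension d.

open import Defs
open import Data.Product using (_×_; _,_)
open import Relation.Nullary using (¬_)

module Binary where

  open import Data.Bool using (Bool; true; false; not; _xor_)
  open import Data.List using (List; []; _∷_; _++_; [_]; foldr; length)
  open import Data.Nat using (ℕ; zero; suc; _+_; _*_; _^_; _≤_; _<_; z≤n; s≤s; s≤s⁻¹; _≡ᵇ_; NonZero)
  open import Function using (_∘_)
  open import Data.Nat.Properties
  open import Data.Nat.DivMod
  open import Data.Fin using (zero; suc)
  open import Relation.Binary.PropositionalEquality hiding ([_])
  open ≡-Reasoning
  open import Data.Nat.Tactic.RingSolver using (solve-∀)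

  val : List Bool → ℕ
  val []          = 0
  val (false ∷ w) = val w * 2
  val (true ∷ w)  = 1 + val w * 2

  private
    suc/2≤ : ∀ k → suc k / 2 ≤ k
    suc/2≤ k = s≤s⁻¹ (m/n<m (suc k) 2 (s≤s (s≤s z≤n)))

    bitsAux-fuel : ∀ f g n → n ≤ f → n ≤ g → bitsAux f n ≡ bitsAux g n
    bitsAux-fuel zero    zero    zero    _       _       = refl
    bitsAux-fuel zero    (suc g) zero    _       _       = refl
    bitsAux-fuel (suc f) zero    zero    _       _       = refl
    bitsAux-fuel (suc f) (suc g) zero    _       _       = refl
    bitsAux-fuel (suc f) (suc g) (suc k) (s≤s p) (s≤s q) =
      cong (_ ∷_) (bitsAux-fuel f g (suc k / 2) (≤-trans (suc/2≤ k) p) (≤-trans (suc/2≤ k) q))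

    shift-even : ∀ a q → 2 * a + q * 2 ≡ (a + q) * 2
    shift-even = solve-∀

    shift-odd : ∀ a q → 2 * a + (1 + q * 2) ≡ 1 + (a + q) * 2
    shift-odd = solve-∀

    m*2<2*n⇒m<n : ∀ {q n} → q * 2 < 2 * n → q < n
    m*2<2*n⇒m<n {q} {n} q*2<2n = *-cancelʳ-< 2 q n (subst (q * 2 <_) (*-comm 2 n) q*2<2n)

  rep2-suc : ∀ k → rep2 (suc k) ≡ (suc k % 2 ≡ᵇ 1) ∷ rep2 (suc k / 2)
  rep2-suc k = cong ((suc k % 2 ≡ᵇ 1) ∷_) (bitsAux-fuel k (suc k / 2) (suc k / 2) (suc/2≤ k) ≤-refl)

  rep2-odd : ∀ m → rep2 (1 + m * 2) ≡ true ∷ rep2 m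
  rep2-odd m = trans (rep2-suc (m * 2)) (cong₂ (λ r q → (r ≡ᵇ 1) ∷ rep2 q) odd%2 odd/2)
    where
    odd%2 : (1 + m * 2) % 2 ≡ 1
    odd%2 = [m+kn]%n≡m%n 1 m 2
    odd/2 : (1 + m * 2) / 2 ≡ m
    odd/2 = trans (+-distrib-/ 1 (m * 2) (subst (λ r → 1 + r < 2) (sym (m*n%n≡0 m 2)) ≤-refl))
                  (m*n/n≡m m 2)

  rep2-even : ∀ n .{{_ : NonZero n}} → rep2 (n * 2) ≡ false ∷ rep2 n
  rep2-even (suc m) = trans (rep2-suc (suc (m * 2)))
    (cong₂ (λ r q → (r ≡ᵇ 1) ∷ rep2 q) (m*n%n≡0 (suc m) 2) (m*n/n≡m (suc m) 2))

  val-++-true-nonZero : ∀ w → NonZero (val (w ++ [ true ]))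
  val-++-true-nonZero []          = _
  val-++-true-nonZero (true ∷ w)  = _
  val-++-true-nonZero (false ∷ w) = m*n≢0 _ 2 {{val-++-true-nonZero w}}

  rep2-val : ∀ w → rep2 (val (w ++ [ true ])) ≡ w ++ [ true ]
  rep2-val []          = refl
  rep2-val (true ∷ w)  = trans (rep2-odd _) (cong (true ∷_) (rep2-val w))
  rep2-val (false ∷ w) = trans (rep2-even _ {{val-++-true-nonZero w}}) (cong (false ∷_) (rep2-val w))

  length-rep2-2^ : ∀ p → length (rep2 (2 ^ p)) ≡ suc p
  length-rep2-2^ zero    = refl
  length-rep2-2^ (suc p) = begin
    length (rep2 (2 * 2 ^ p))        ≡⟨ cong (length ∘ rep2) (*-comm 2 (2 ^ p)) ⟩
    length (rep2 (2 ^ p * 2))        ≡⟨ cong length (rep2-even (2 ^ p) {{m^n≢0 2 p}}) ⟩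
    suc (length (rep2 (2 ^ p)))      ≡⟨ cong suc (length-rep2-2^ p) ⟩
    suc (suc p)                      ∎

  thueMorse-odd : ∀ m → thueMorse (1 + m * 2) ≡ not (thueMorse m)
  thueMorse-odd m = cong (foldr _xor_ false) (rep2-odd m)

  thueMorse-even : ∀ m → thueMorse (m * 2) ≡ thueMorse m
  thueMorse-even zero    = refl
  thueMorse-even (suc m) = cong (foldr _xor_ false) (rep2-even (suc m))

  thueMorse-2^+ : ∀ k r → r < 2 ^ k → thueMorse (2 ^ k + r) ≡ not (thueMorse r)
  thueMorse-2^+ zero    zero    _         = refl
  thueMorse-2^+ zero    (suc r) (s≤s ())
  thueMorse-2^+ (suc k) r  r<2^k+1 with r divMod 2
  ... | result q zero refl = begin
    thueMorse (2 * 2 ^ k + q * 2)  ≡⟨ cong thueMorse (shift-even (2 ^ k) q) ⟩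
    thueMorse ((2 ^ k + q) * 2)    ≡⟨ thueMorse-even (2 ^ k + q) ⟩
    thueMorse (2 ^ k + q)          ≡⟨ thueMorse-2^+ k q (m*2<2*n⇒m<n r<2^k+1) ⟩
    not (thueMorse q)              ≡⟨ cong not (thueMorse-even q) ⟨
    not (thueMorse (q * 2))        ∎
  ... | result q (suc zero) refl = begin
    thueMorse (2 * 2 ^ k + (1 + q * 2))  ≡⟨ cong thueMorse (shift-odd (2 ^ k) q) ⟩
    thueMorse (1 + (2 ^ k + q) * 2)      ≡⟨ thueMorse-odd (2 ^ k + q) ⟩
    not (thueMorse (2 ^ k + q))          ≡⟨ cong not (thueMorse-2^+ k q (m*2<2*n⇒m<n (≤-trans (n≤1+n _) r<2^k+1))) ⟩
    not (not (thueMorse q))              ≡⟨ cong not (thueMorse-odd q) ⟨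
    not (thueMorse (1 + q * 2))          ∎

  thueMorse-2^ : ∀ k → thueMorse (2 ^ k) ≡ true
  thueMorse-2^ k = begin
    thueMorse (2 ^ k)      ≡⟨ cong thueMorse (+-identityʳ (2 ^ k)) ⟨
    thueMorse (2 ^ k + 0)  ≡⟨ thueMorse-2^+ k 0 (m^n>0 2 k) ⟩
    true                   ∎

  thueMorse-2^+2^ : ∀ {i j} → i < j → thueMorse (2 ^ j + 2 ^ i) ≡ false
  thueMorse-2^+2^ {i} {j} i<j = begin
    thueMorse (2 ^ j + 2 ^ i)  ≡⟨ thueMorse-2^+ j (2 ^ i) (^-monoʳ-< 2 ≤-refl i<j) ⟩
    not (thueMorse (2 ^ i))    ≡⟨ cong not (thueMorse-2^ i) ⟩
    false                      ∎

  thueMorse-2^+2^-diagonal : ∀ i → thueMorse (2 ^ i + 2 ^ i) ≡ true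
  thueMorse-2^+2^-diagonal i = trans (cong thueMorse (double (2 ^ i))) (thueMorse-2^ (suc i))
    where
    double : ∀ a → a + a ≡ 2 * a
    double = solve-∀


module Language where

  open import Data.Bool using (Bool; true; false; not; _∧_; if_then_else_)
  open import Data.Bool.Properties using (∧-identityʳ; not-involutive)
  open import Data.List using ([]; _∷_; _++_; [_]; map; filterᵇ; length; replicate)
  open import Data.List.Properties using (length-++; filter-++)
  open import Data.Nat using (ℕ; zero; suc; _+_; _*_; _^_; _≤_)
  open import Data.Nat.Properties
  open import Relation.Nullary.Decidable using (T?)
  open import Function using (_∘_)
  open import Relation.Binary.PropositionalEquality hiding ([_])
  open Binary

  length-filterᵇ-map : ∀ {A B : Set} (p : B → Bool) (f : A → B) (q : A → Bool) →
                       (∀ x → p (f x) ≡ q x) → ∀ xs → length (filterᵇ p (map f xs)) ≡ length (filterᵇ q xs)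
  length-filterᵇ-map p f q p∘f≗q []       = refl
  length-filterᵇ-map p f q p∘f≗q (x ∷ xs) rewrite p∘f≗q x with q x
  ... | true  = cong suc (length-filterᵇ-map p f q p∘f≗q xs)
  ... | false = length-filterᵇ-map p f q p∘f≗q xs

  okFrom-true : ∀ i r → okFrom i (true ∷ r) ≡ okFrom (suc i) r
  okFrom-true i []          = refl
  okFrom-true i (true ∷ r)  = refl
  okFrom-true i (false ∷ r) = refl

  okFrom-false : ∀ i r → thueMorse i ≡ true → okFrom i (false ∷ r) ≡ okFrom (suc i) r
  okFrom-false i []          _   = refl
  okFrom-false i (true ∷ r)  t≡1 rewrite t≡1 = refl
  okFrom-false i (false ∷ r) _   = refl

  okFrom-zeros-true : ∀ i k → okFrom i (replicate (suc k) false ++ [ true ]) ≡ thueMorse (i + k)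
  okFrom-zeros-true i zero    = begin
    not (not (thueMorse i)) ∧ true  ≡⟨ ∧-identityʳ _ ⟩
    not (not (thueMorse i))         ≡⟨ not-involutive _ ⟩
    thueMorse i                     ≡⟨ cong thueMorse (+-identityʳ i) ⟨
    thueMorse (i + 0)               ∎
    where open ≡-Reasoning
  okFrom-zeros-true i (suc k) = trans (okFrom-zeros-true (suc i) k) (cong thueMorse (sym (+-suc i k)))

  startsWith0-++-true : ∀ w → startsWith0 (w ++ [ true ]) ≡ false
  startsWith0-++-true []          = refl
  startsWith0-++-true (a ∷ [])    = refl
  startsWith0-++-true (a ∷ b ∷ w) = startsWith0-++-true (b ∷ w)

  v≡inLJ' : ∀ n → v n ≡ (if inLJ' (rep2 n) then 1 else 0)
  v≡inLJ' n with inLJ' (rep2 n)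
  ... | true  = refl
  ... | false = refl

  v-val : ∀ w → v (val (w ++ [ true ])) ≡ (if okFrom 0 (w ++ [ true ]) then 1 else 0)
  v-val w = begin
    v (val (w ++ [ true ]))                                    ≡⟨ v≡inLJ' (val (w ++ [ true ])) ⟩
    (if inLJ' (rep2 (val (w ++ [ true ]))) then 1 else 0)       ≡⟨ cong (λ x → if inLJ' x then 1 else 0) (rep2-val w) ⟩
    (if okFrom 0 (w ++ [ true ]) ∧ not (startsWith0 (w ++ [ true ])) then 1 else 0)
      ≡⟨ cong (λ b → if okFrom 0 (w ++ [ true ]) ∧ not b then 1 else 0) (startsWith0-++-true w) ⟩
    (if okFrom 0 (w ++ [ true ]) ∧ true then 1 else 0)        ≡⟨ cong (λ b → if b then 1 else 0) (∧-identityʳ _) ⟩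
    (if okFrom 0 (w ++ [ true ]) then 1 else 0)                ∎
    where open ≡-Reasoning

  v-zeros-true : ∀ k → v (val (replicate (suc k) false ++ [ true ])) ≡ (if thueMorse k then 1 else 0)
  v-zeros-true k = trans (v-val (replicate (suc k) false)) (cong (λ b → if b then 1 else 0) (okFrom-zeros-true 0 k))

  countOkFrom : ℕ → ℕ → ℕ
  countOkFrom i n = length (filterᵇ (okFrom i) (allWords n))

  countOkFrom-suc : ∀ i n → countOkFrom i (suc n) ≡
                    length (filterᵇ (okFrom i) (map (false ∷_) (allWords n))) + countOkFrom (suc i) n
  countOkFrom-suc i n = begin
    length (filterᵇ (okFrom i) (zeros ++ ones))
      ≡⟨ cong length (filter-++ (T? ∘ okFrom i) zeros ones) ⟩
    length (filterᵇ (okFrom i) zeros ++ filterᵇ (okFrom i) ones)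
      ≡⟨ length-++ (filterᵇ (okFrom i) zeros) ⟩
    length (filterᵇ (okFrom i) zeros) + length (filterᵇ (okFrom i) ones)
      ≡⟨ cong (length (filterᵇ (okFrom i) zeros) +_)
              (length-filterᵇ-map (okFrom i) (true ∷_) (okFrom (suc i)) (okFrom-true i) (allWords n)) ⟩
    length (filterᵇ (okFrom i) zeros) + countOkFrom (suc i) n ∎
    where
    open ≡-Reasoning
    zeros = map (false ∷_) (allWords n)
    ones  = map (true ∷_) (allWords n)

  weight : Bool → ℕ
  weight true  = 2
  weight false = 1

  weight-complement : ∀ b c → weight b * (weight (not b) * c) ≡ 2 * c
  weight-complement true  c = cong (2 *_) (*-identityˡ c)
  weight-complement false c = *-identityˡ (2 * c)

  countOkFrom-suc-≥ : ∀ i n → weight (thueMorse i) * countOkFrom (suc i) n ≤ countOkFrom i (suc n)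
  countOkFrom-suc-≥ i n with thueMorse i in tᵢ≡b
  ... | true  = ≤-reflexive (begin
    c + (c + 0)  ≡⟨ cong (_+ (c + 0)) (length-filterᵇ-map (okFrom i) (false ∷_) (okFrom (suc i))
                                         (λ r → okFrom-false i r tᵢ≡b) (allWords n)) ⟨
    z + (c + 0)  ≡⟨ cong (z +_) (+-identityʳ c) ⟩
    z + c        ≡⟨ countOkFrom-suc i n ⟨
    countOkFrom i (suc n) ∎)
    where
    open ≡-Reasoning
    c = countOkFrom (suc i) n
    z = length (filterᵇ (okFrom i) (map (false ∷_) (allWords n)))
  ... | false = begin
    1 * countOkFrom (suc i) n  ≡⟨ *-identityˡ _ ⟩
    countOkFrom (suc i) n      ≤⟨ m≤n+m _ _ ⟩
    _ + countOkFrom (suc i) n  ≡⟨ countOkFrom-suc i n ⟨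
    countOkFrom i (suc n)      ∎
    where open ≤-Reasoning

  countOkFrom-even : ∀ m k → 2 ^ m ≤ countOkFrom (k * 2) (m * 2)
  countOkFrom-even zero    k = ≤-refl
  countOkFrom-even (suc m) k = begin
    2 * 2 ^ m
      ≤⟨ *-monoʳ-≤ 2 (countOkFrom-even m (suc k)) ⟩
    2 * c
      ≡⟨ trans (cong₂ (λ b b′ → weight b * (weight b′ * c)) (thueMorse-even k) (thueMorse-odd k))
               (weight-complement (thueMorse k) c) ⟨
    weight (thueMorse (k * 2)) * (weight (thueMorse (1 + k * 2)) * c)
      ≤⟨ *-monoʳ-≤ (weight (thueMorse (k * 2))) (countOkFrom-suc-≥ (1 + k * 2) (m * 2)) ⟩
    weight (thueMorse (k * 2)) * countOkFrom (1 + k * 2) (suc (m * 2))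
      ≤⟨ countOkFrom-suc-≥ (k * 2) (suc (m * 2)) ⟩
    countOkFrom (k * 2) (suc m * 2) ∎
    where
    open ≤-Reasoning
    c = countOkFrom (suc k * 2) (m * 2)

  u-lower : ∀ m → 2 ^ m ≤ u (m * 2)
  u-lower m = countOkFrom-even m 0


module LinearAlgebra where

  open import Data.Nat using (ℕ; zero; suc; _≤_; _<_; z≤n; s≤s)
  open import Data.Nat.Properties using (≤-trans; ≤-reflexive; <-irrefl)
  open import Data.Fin using (Fin; zero; suc)
  open import Data.List using (List; []; _∷_; map; length; applyUpTo)
  open import Data.List.Properties using (length-map; length-applyUpTo)
  open import Data.List.Relation.Unary.All as All using (All; []; _∷_; zipWith)
  open import Data.List.Relation.Unary.All.Properties using (map⁺; applyUpTo⁺₂)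
  open import Data.Product using (_×_; _,_; proj₂)
  open import Data.Unit using (⊤; tt)
  open import Data.Empty using (⊥)
  open import Function using (_∘_)
  open import Relation.Nullary using (yes; no; contradiction)
  open import Data.Rational using (ℚ; 0ℚ; 1ℚ; _+_; _*_; _-_; -_; 1/_; ≢-nonZero)
  open import Data.Rational.Properties
    using (_≟_; +-*-commutativeRing; *-assoc; *-identityˡ; *-inverseˡ; *-zeroˡ; *-zeroʳ; +-identityˡ; neg-distribˡ-*)
  open import Data.Rational.Solver using (module +-*-Solver)
  open import Algebra.Bundles using (CommutativeRing)
  open import Algebra.Properties.Semiring.Sum (CommutativeRing.semiring +-*-commutativeRing)
    using (sum; sum-syntax; sum-cong-≗; ∑-comm; ∑-distrib-+; *-distribˡ-sum; *-distribʳ-sum)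
  open import Data.Vec.Functional using (Vector; head; tail)
  open import Relation.Binary.PropositionalEquality
  open ≡-Reasoning
  open +-*-Solver

  private
    variable
      m n : ℕ

  sumFin≡sum : ∀ d (f : Fin d → ℚ) → sumFin d f ≡ sum f
  sumFin≡sum zero    f = refl
  sumFin≡sum (suc d) f = cong (f zero +_) (sumFin≡sum d (tail f))

  infix 7 _∙_
  infixl 7 _ᵛ*_
  infixr 7 _*ᵛ_

  _∙_ : Vector ℚ n → Vector ℚ n → ℚ
  a ∙ b = sum (λ k → a k * b k)

  _*ᵛ_ : (Fin m → Fin n → ℚ) → Vector ℚ n → Vector ℚ m
  (P *ᵛ w) i = P i ∙ w

  _ᵛ*_ : Vector ℚ m → (Fin m → Fin n → ℚ) → Vector ℚ n
  (v ᵛ* P) j = v ∙ (λ i → P i j)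

  ∙-congʳ : ∀ (a : Vector ℚ n) {b c} → (∀ k → b k ≡ c k) → a ∙ b ≡ a ∙ c
  ∙-congʳ a b≗c = sum-cong-≗ (λ k → cong (a k *_) (b≗c k))

  ∙-*ᵛ-assoc : ∀ {m n} (v : Vector ℚ m) (P : Fin m → Fin n → ℚ) w → v ∙ (P *ᵛ w) ≡ (v ᵛ* P) ∙ w
  ∙-*ᵛ-assoc {m} {n} v P w = begin
    ∑[ i < m ] (v i * ∑[ j < n ] (P i j * w j))      ≡⟨ sum-cong-≗ (λ i → *-distribˡ-sum (v i) (λ j → P i j * w j)) ⟩
    ∑[ i < m ] ∑[ j < n ] (v i * (P i j * w j))    ≡⟨ sum-cong-≗ (λ i → sum-cong-≗ (λ j → sym (*-assoc (v i) (P i j) (w j)))) ⟩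
    ∑[ i < m ] ∑[ j < n ] (v i * P i j * w j)      ≡⟨ ∑-comm (λ i j → v i * P i j * w j) ⟩
    ∑[ j < n ] ∑[ i < m ] (v i * P i j * w j)      ≡⟨ sum-cong-≗ (λ j → *-distribʳ-sum (w j) (λ i → v i * P i j)) ⟨
    ∑[ j < n ] (∑[ i < m ] (v i * P i j) * w j)    ∎

  bilinear≡∙*ᵛ : ∀ d V (P : Matrix d) W → bilinear d V P W ≡ V ∙ (P *ᵛ W)
  bilinear≡∙*ᵛ d V P W =
    trans (sumFin≡sum d (λ i → sumFin d (λ j → V i * (P i j * W j)))) (sum-cong-≗ (λ i →
      trans (sumFin≡sum d (λ j → V i * (P i j * W j))) (sym (*-distribˡ-sum (V i) (λ j → P i j * W j)))))

  mul-*ᵛ : ∀ d (P Q : Matrix d) w i → (mul d P Q *ᵛ w) i ≡ (P *ᵛ (Q *ᵛ w)) i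
  mul-*ᵛ d P Q w i = begin
    ∑[ j < d ] (mul d P Q i j * w j)  ≡⟨ sum-cong-≗ (λ j → cong (_* w j) (sumFin≡sum d (λ k → P i k * Q k j))) ⟩
    (P i ᵛ* Q) ∙ w                   ≡⟨ ∙-*ᵛ-assoc (P i) Q w ⟨
    P i ∙ (Q *ᵛ w)                   ∎

  *-≢0 : ∀ p q → p ≢ 0ℚ → q ≢ 0ℚ → p * q ≢ 0ℚ
  *-≢0 p q p≢0 q≢0 pq≡0 = q≢0 (begin
    q                 ≡⟨ *-identityˡ q ⟨
    1ℚ * q            ≡⟨ cong (_* q) (*-inverseˡ p) ⟨
    1/ p * p * q      ≡⟨ *-assoc (1/ p) p q ⟩
    1/ p * (p * q)    ≡⟨ cong (1/ p *_) pq≡0 ⟩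
    1/ p * 0ℚ         ≡⟨ *-zeroʳ (1/ p) ⟩
    0ℚ                ∎)
    where instance _ = ≢-nonZero p≢0

  ∙-tail : ∀ (a b : Vector ℚ (suc n)) → head a ≡ 0ℚ → a ∙ b ≡ tail a ∙ tail b
  ∙-tail a b a₀≡0 = begin
    head a * head b + tail a ∙ tail b  ≡⟨ cong (λ x → x * head b + tail a ∙ tail b) a₀≡0 ⟩
    0ℚ * head b + tail a ∙ tail b      ≡⟨ cong (_+ tail a ∙ tail b) (*-zeroˡ (head b)) ⟩
    0ℚ + tail a ∙ tail b               ≡⟨ +-identityˡ _ ⟩
    tail a ∙ tail b                    ∎

  clearHead : Vector ℚ (suc n) → Vector ℚ (suc n) → Vector ℚ (suc n)
  clearHead a c k = head a * c k - head c * a k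

  head-clearHead : ∀ (a c : Vector ℚ (suc n)) → head (clearHead a c) ≡ 0ℚ
  head-clearHead a c = solve 2 (λ x y → x :* y :- y :* x := con 0ℚ) refl (head a) (head c)

  ∙-clearHead : ∀ (a c b : Vector ℚ (suc n)) → clearHead a c ∙ b ≡ head a * (c ∙ b) - head c * (a ∙ b)
  ∙-clearHead {n} a c b = begin
    ∑[ k < suc n ] ((head a * c k - head c * a k) * b k)
      ≡⟨ sum-cong-≗ (λ k → expand (head a) (head c) (c k) (a k) (b k)) ⟩
    ∑[ k < suc n ] (head a * (c k * b k) + - head c * (a k * b k))
      ≡⟨ ∑-distrib-+ (λ k → head a * (c k * b k)) (λ k → - head c * (a k * b k)) ⟩
    ∑[ k < suc n ] (head a * (c k * b k)) + ∑[ k < suc n ] (- head c * (a k * b k))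
      ≡⟨ cong₂ _+_ (*-distribˡ-sum (head a) (λ k → c k * b k)) (*-distribˡ-sum (- head c) (λ k → a k * b k)) ⟨
    head a * (c ∙ b) + - head c * (a ∙ b)
      ≡⟨ cong (head a * (c ∙ b) +_) (neg-distribˡ-* (head c) (a ∙ b)) ⟨
    head a * (c ∙ b) - head c * (a ∙ b) ∎
    where
    expand : ∀ x y cₖ aₖ bₖ → (x * cₖ - y * aₖ) * bₖ ≡ x * (cₖ * bₖ) + - y * (aₖ * bₖ)
    expand = solve 5 (λ x y cₖ aₖ bₖ → (x :* cₖ :- y :* aₖ) :* bₖ := x :* (cₖ :* bₖ) :+ (:- y) :* (aₖ :* bₖ)) refl

  ∙-tail-clearHead : ∀ (a c b : Vector ℚ (suc n)) → a ∙ b ≡ 0ℚ → tail (clearHead a c) ∙ tail b ≡ head a * (c ∙ b)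
  ∙-tail-clearHead a c b a∙b≡0 = begin
    tail (clearHead a c) ∙ tail b        ≡⟨ ∙-tail (clearHead a c) b (head-clearHead a c) ⟨
    clearHead a c ∙ b                    ≡⟨ ∙-clearHead a c b ⟩
    head a * (c ∙ b) - head c * (a ∙ b)  ≡⟨ cong (λ x → head a * (c ∙ b) - head c * x) a∙b≡0 ⟩
    head a * (c ∙ b) - head c * 0ℚ       ≡⟨ solve 2 (λ x y → x :- y :* con 0ℚ := x) refl (head a * (c ∙ b)) (head c) ⟩
    head a * (c ∙ b)                     ∎

  Triangular : List (Vector ℚ n × Vector ℚ n) → Set
  Triangular []             = ⊤
  Triangular ((a , b) ∷ ps) = a ∙ b ≢ 0ℚ × All (λ p → a ∙ proj₂ p ≡ 0ℚ) ps × Triangular ps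

  clearHeadPair : Vector ℚ (suc n) → Vector ℚ (suc n) × Vector ℚ (suc n) → Vector ℚ n × Vector ℚ n
  clearHeadPair a (c , b) = tail (clearHead a c) , tail b

  -- One step of Gaussian elimination on the first coordinate.  The first pair (a , b) whose a
  -- has a nonzero head is the pivot and is dropped; the a's before it already have zero head,
  -- and each later a′ becomes clearHead a a′, whose dot product with any later b′ is
  -- head a * (a′ ∙ b′) because a ∙ b′ = 0.
  eliminate : List (Vector ℚ (suc n) × Vector ℚ (suc n)) → List (Vector ℚ n × Vector ℚ n)
  eliminate []             = []
  eliminate ((a , b) ∷ ps) with head a ≟ 0ℚ
  ... | yes _ = (tail a , tail b) ∷ eliminate ps
  ... | no  _ = map (clearHeadPair a) ps

  length-eliminate : ∀ (ps : List (Vector ℚ (suc n) × Vector ℚ (suc n))) → length ps ≤ suc (length (eliminate ps))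
  length-eliminate []             = z≤n
  length-eliminate ((a , b) ∷ ps) with head a ≟ 0ℚ
  ... | yes _ = s≤s (length-eliminate ps)
  ... | no  _ = s≤s (≤-reflexive (sym (length-map (clearHeadPair a) ps)))

  eliminate-All-proj₂ : ∀ (P : Vector ℚ n → Set) ps →
                        All (λ p → P (tail (proj₂ p))) ps → All (λ p → P (proj₂ p)) (eliminate ps)
  eliminate-All-proj₂ P []             []         = []
  eliminate-All-proj₂ P ((a , b) ∷ ps) (pb ∷ pps) with head a ≟ 0ℚ
  ... | yes _ = pb ∷ eliminate-All-proj₂ P ps pps
  ... | no  _ = map⁺ pps

  clearHead-triangular : ∀ (a : Vector ℚ (suc n)) ps → head a ≢ 0ℚ →
                         All (λ p → a ∙ proj₂ p ≡ 0ℚ) ps → Triangular ps → Triangular (map (clearHeadPair a) ps)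
  clearHead-triangular a []              a₀≢0 []            _                    = tt
  clearHead-triangular a ((c , b) ∷ ps) a₀≢0 (a⊥b ∷ a⊥ps) (c∙b≢0 , c⊥ps , tri) =
      (λ eq → *-≢0 (head a) (c ∙ b) a₀≢0 c∙b≢0 (trans (sym (∙-tail-clearHead a c b a⊥b)) eq))
    , map⁺ (zipWith (λ { {_ , b′} (c⊥b′ , a⊥b′) →
                         trans (∙-tail-clearHead a c b′ a⊥b′) (trans (cong (head a *_) c⊥b′) (*-zeroʳ (head a))) })
                    (c⊥ps , a⊥ps))
    , clearHead-triangular a ps a₀≢0 a⊥ps tri

  eliminate-triangular : ∀ (ps : List (Vector ℚ (suc n) × Vector ℚ (suc n))) → Triangular ps → Triangular (eliminate ps)
  eliminate-triangular []             tt                    = tt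
  eliminate-triangular ((a , b) ∷ ps) (a∙b≢0 , a⊥ps , tri) with head a ≟ 0ℚ
  ... | yes a₀≡0 =
      (λ eq → a∙b≢0 (trans (∙-tail a b a₀≡0) eq))
    , eliminate-All-proj₂ (λ b′ → tail a ∙ b′ ≡ 0ℚ) ps
        (All.map (λ {p} a⊥p → trans (sym (∙-tail a (proj₂ p) a₀≡0)) a⊥p) a⊥ps)
    , eliminate-triangular ps tri
  ... | no  a₀≢0 = clearHead-triangular a ps a₀≢0 a⊥ps tri

  triangular-length≤ : ∀ (ps : List (Vector ℚ n × Vector ℚ n)) → Triangular ps → length ps ≤ n
  triangular-length≤ {zero}  []             _             = z≤n
  triangular-length≤ {zero}  ((a , b) ∷ ps) (a∙b≢0 , _)  = contradiction refl a∙b≢0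
  triangular-length≤ {suc n} ps             tri           =
    ≤-trans (length-eliminate ps) (s≤s (triangular-length≤ (eliminate ps) (eliminate-triangular ps tri)))

  no-infinite-triangular-family : ∀ (a b : ℕ → Vector ℚ n) →
    (∀ i → a i ∙ b i ≢ 0ℚ) → (∀ {i j} → i < j → a i ∙ b j ≡ 0ℚ) → ⊥
  no-infinite-triangular-family {n} a b diagonal upper =
    <-irrefl refl (subst (_≤ n) (length-applyUpTo pair (suc n))
                         (triangular-length≤ (applyUpTo pair (suc n)) (applyUpTo-triangular (suc n) a b diagonal upper)))
    where
    pair = λ i → a i , b i
    applyUpTo-triangular : ∀ k (a b : ℕ → Vector ℚ n) → (∀ i → a i ∙ b i ≢ 0ℚ) → (∀ {i j} → i < j → a i ∙ b j ≡ 0ℚ) →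
                           Triangular (applyUpTo (λ i → a i , b i) k)
    applyUpTo-triangular zero    a b diagonal upper = tt
    applyUpTo-triangular (suc k) a b diagonal upper =
        diagonal 0
      , applyUpTo⁺₂ (λ i → a (suc i) , b (suc i)) k (λ i → upper (s≤s z≤n))
      , applyUpTo-triangular k (a ∘ suc) (b ∘ suc) (diagonal ∘ suc) (upper ∘ s≤s)


module RegularSequences where

  open import Data.Bool using (Bool; true)
  open import Data.List using (List; []; _∷_; _++_; [_])
  open import Data.List.Properties using (++-assoc)
  open import Data.Nat using (ℕ)
  open import Data.Rational using (ℚ)
  open import Data.Vec.Functional using (Vector)
  open import Relation.Binary.PropositionalEquality hiding ([_])
  open ≡-Reasoning
  open Binary
  open LinearAlgebra

  wordAction : ∀ {d} → (Bool → Matrix d) → List Bool → Vector ℚ d → Vector ℚ d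
  wordAction M []      w = w
  wordAction M (b ∷ y) w = wordAction M y (M b *ᵛ w)

  prodWord-++-*ᵛ : ∀ d (M : Bool → Matrix d) y x w i →
                   (prodWord d M (y ++ x) *ᵛ w) i ≡ (prodWord d M x *ᵛ wordAction M y w) i
  prodWord-++-*ᵛ d M []      x w i = refl
  prodWord-++-*ᵛ d M (b ∷ y) x w i =
    trans (mul-*ᵛ d (prodWord d M (y ++ x)) (M b) w i) (prodWord-++-*ᵛ d M y x (M b *ᵛ w) i)

  module _ {s : ℕ → ℚ} (R : Regular2 s) where

    open Regular2 R renaming (dim to d)

    regular-val : ∀ w → s (val (w ++ [ true ])) ≡ bilinear d V (prodWord d M (w ++ [ true ])) W
    regular-val w = trans (rep (val (w ++ [ true ]))) (cong (λ w′ → bilinear d V (prodWord d M w′) W) (rep2-val w))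

    regular-split : ∀ y x → s (val ((y ++ x) ++ [ true ])) ≡ (V ᵛ* prodWord d M (x ++ [ true ])) ∙ wordAction M y W
    regular-split y x = begin
      s (val ((y ++ x) ++ [ true ]))                ≡⟨ regular-val (y ++ x) ⟩
      bilinear d V (prodWord d M ((y ++ x) ++ [ true ])) W
        ≡⟨ cong (λ w → bilinear d V (prodWord d M w) W) (++-assoc y x [ true ]) ⟩
      bilinear d V (prodWord d M (y ++ x′)) W       ≡⟨ bilinear≡∙*ᵛ d V (prodWord d M (y ++ x′)) W ⟩
      V ∙ (prodWord d M (y ++ x′) *ᵛ W)             ≡⟨ ∙-congʳ V (prodWord-++-*ᵛ d M y x′ W) ⟩
      V ∙ (prodWord d M x′ *ᵛ wordAction M y W)     ≡⟨ ∙-*ᵛ-assoc V (prodWord d M x′) (wordAction M y W) ⟩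
      (V ᵛ* prodWord d M x′) ∙ wordAction M y W     ∎
      where x′ = x ++ [ true ]


module Growth where

  open import Data.Bool using (Bool; true; false)
  open import Data.Fin using (Fin; zero; suc)
  open import Data.Integer as ℤ using (+_; +≤+)
  import Data.Integer.Properties as ℤ
  open import Data.List using ([]; _∷_; length)
  open import Data.Nat as ℕ using (ℕ; zero; suc; _⊔_; z≤n; s≤s)
  import Data.Nat.Properties as ℕ
  import Data.Nat.Coprimality as Coprime
  open import Data.Nat.Tactic.RingSolver using (solve-∀)
  open import Data.Product using (∃-syntax; _,_; proj₁; proj₂)
  open import Data.Rational using (ℚ; mkℚ; _+_; _*_; ∣_∣; _≤_; *≤*; ↥_; NonNegative; nonNegative)
  open import Data.Rational.Properties
    using (≤-refl; ≤-trans; +-mono-≤; *-monoˡ-≤-nonNeg; *-monoʳ-≤-nonNeg; ∣p+q∣≤∣p∣+∣q∣; ∣p*q∣≡∣p∣*∣q∣;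
           ∣-∣-nonNeg; normalize-coprime; 0≤p⇒∣p∣≡p)
  open import Data.Vec.Functional using (Vector; tail)
  open import Function using (_∘_)
  open import Relation.Binary.PropositionalEquality
  open Binary
  open LinearAlgebra

  toℚ≡mkℚ : ∀ n → toℚ n ≡ mkℚ (+ n) 0 (Coprime.sym (Coprime.1-coprimeTo n))
  toℚ≡mkℚ n = normalize-coprime (Coprime.sym (Coprime.1-coprimeTo n))

  toℚ-+ : ∀ m n → toℚ (m ℕ.+ n) ≡ toℚ m + toℚ n
  toℚ-+ m n = sym (trans (cong₂ _+_ (toℚ≡mkℚ m) (toℚ≡mkℚ n))
    (cong₂ (λ x y → (x ℤ.+ y) Data.Rational./ 1) (ℤ.*-identityʳ (+ m)) (ℤ.*-identityʳ (+ n))))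

  toℚ-* : ∀ m n → toℚ (m ℕ.* n) ≡ toℚ m * toℚ n
  toℚ-* m n = sym (trans (cong₂ _*_ (toℚ≡mkℚ m) (toℚ≡mkℚ n)) (cong (Data.Rational._/ 1) (sym (ℤ.pos-* m n))))

  toℚ-mono-≤ : ∀ {m n} → m ℕ.≤ n → toℚ m ≤ toℚ n
  toℚ-mono-≤ {m} {n} m≤n =
    subst₂ _≤_ (sym (toℚ≡mkℚ m)) (sym (toℚ≡mkℚ n)) (*≤* (ℤ.*-monoʳ-≤-nonNeg (+ 1) (+≤+ m≤n)))

  toℚ-cancel-≤ : ∀ {m n} → toℚ m ≤ toℚ n → m ℕ.≤ n
  toℚ-cancel-≤ {m} {n} toℚm≤toℚn with subst₂ _≤_ (toℚ≡mkℚ m) (toℚ≡mkℚ n) toℚm≤toℚn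
  ... | *≤* m*1≤n*1 = ℤ.drop‿+≤+ (subst₂ ℤ._≤_ (ℤ.*-identityʳ (+ m)) (ℤ.*-identityʳ (+ n)) m*1≤n*1)

  height : ℚ → ℕ
  height q = ℤ.∣ ↥ q ∣

  ∣q∣≤height : ∀ q → ∣ q ∣ ≤ toℚ (height q)
  ∣q∣≤height (mkℚ n d-1 c) = subst (∣ mkℚ n d-1 c ∣ ≤_) (sym (toℚ≡mkℚ ℤ.∣ n ∣))
    (*≤* (ℤ.*-monoˡ-≤-nonNeg (+ ℤ.∣ n ∣) (+≤+ (s≤s z≤n))))

  toℚ-nonNeg : ∀ n → NonNegative (toℚ n)
  toℚ-nonNeg n = nonNegative (toℚ-mono-≤ {0} {n} z≤n)

  ∣*∣≤ : ∀ {x y a b} → ∣ x ∣ ≤ toℚ a → ∣ y ∣ ≤ toℚ b → ∣ x * y ∣ ≤ toℚ (a ℕ.* b)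
  ∣*∣≤ {x} {y} {a} {b} ∣x∣≤a ∣y∣≤b = subst₂ _≤_ (sym (∣p*q∣≡∣p∣*∣q∣ x y)) (sym (toℚ-* a b))
    (≤-trans (*-monoʳ-≤-nonNeg ∣ y ∣ {{∣-∣-nonNeg y}} ∣x∣≤a) (*-monoˡ-≤-nonNeg (toℚ a) {{toℚ-nonNeg a}} ∣y∣≤b))

  ∣+∣≤ : ∀ {x y a b} → ∣ x ∣ ≤ toℚ a → ∣ y ∣ ≤ toℚ b → ∣ x + y ∣ ≤ toℚ (a ℕ.+ b)
  ∣+∣≤ {x} {y} {a} {b} ∣x∣≤a ∣y∣≤b =
    ≤-trans (∣p+q∣≤∣p∣+∣q∣ x y) (subst (∣ x ∣ + ∣ y ∣ ≤_) (sym (toℚ-+ a b)) (+-mono-≤ ∣x∣≤a ∣y∣≤b))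

  ∣∙∣≤ : ∀ {n} (x y : Vector ℚ n) {a b} → (∀ k → ∣ x k ∣ ≤ toℚ a) → (∀ k → ∣ y k ∣ ≤ toℚ b) →
         ∣ x ∙ y ∣ ≤ toℚ (n ℕ.* (a ℕ.* b))
  ∣∙∣≤ {zero}  x y ∣x∣≤a ∣y∣≤b = ≤-refl
  ∣∙∣≤ {suc n} x y {a} {b} ∣x∣≤a ∣y∣≤b =
    ∣+∣≤ {a = a ℕ.* b} (∣*∣≤ {a = a} {b} (∣x∣≤a zero) (∣y∣≤b zero)) (∣∙∣≤ (tail x) (tail y) {a} {b} (∣x∣≤a ∘ suc) (∣y∣≤b ∘ suc))

  finite-bound : ∀ {n} (f : Fin n → ℕ) → ∃[ B ] (∀ i → f i ℕ.≤ B)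
  finite-bound {zero}  f = 0 , λ ()
  finite-bound {suc n} f with finite-bound (tail f)
  ... | B , f≤B = f zero ⊔ B , λ { zero → ℕ.m≤m⊔n (f zero) B ; (suc i) → ℕ.≤-trans (f≤B i) (ℕ.m≤n⊔m (f zero) B) }

  vector-bound : ∀ {n} (x : Vector ℚ n) → ∃[ B ] (∀ i → ∣ x i ∣ ≤ toℚ B)
  vector-bound x with finite-bound (height ∘ x)
  ... | B , h≤B = B , λ i → ≤-trans (∣q∣≤height (x i)) (toℚ-mono-≤ (h≤B i))

  matrix-bound : ∀ {m n} (A : Fin m → Fin n → ℚ) → ∃[ B ] (∀ i j → ∣ A i j ∣ ≤ toℚ B)
  matrix-bound A with finite-bound (λ i → proj₁ (vector-bound (A i)))
  ... | B , row≤B = B , λ i j → ≤-trans (proj₂ (vector-bound (A i)) j) (toℚ-mono-≤ (row≤B i))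

  ∣identity∣≤1 : ∀ d (i j : Fin d) → ∣ identity d i j ∣ ≤ toℚ 1
  ∣identity∣≤1 (suc d) zero    zero    = ≤-refl
  ∣identity∣≤1 (suc d) zero    (suc j) = toℚ-mono-≤ {0} {1} z≤n
  ∣identity∣≤1 (suc d) (suc i) zero    = toℚ-mono-≤ {0} {1} z≤n
  ∣identity∣≤1 (suc d) (suc i) (suc j) = ∣identity∣≤1 d i j

  ∣prodWord∣≤ : ∀ d (M : Bool → Matrix d) B → (∀ b i j → ∣ M b i j ∣ ≤ toℚ B) →
                ∀ w i j → ∣ prodWord d M w i j ∣ ≤ toℚ ((d ℕ.* B) ℕ.^ length w)
  ∣prodWord∣≤ d M B ∣M∣≤B []      i j = ∣identity∣≤1 d i j
  ∣prodWord∣≤ d M B ∣M∣≤B (b ∷ w) i j =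
    subst₂ (λ x n → ∣ x ∣ ≤ toℚ n) (sym (sumFin≡sum d (λ k → prodWord d M w i k * M b k j))) (reassoc d B X)
      (∣∙∣≤ (prodWord d M w i) (λ k → M b k j) {X} {B} (∣prodWord∣≤ d M B ∣M∣≤B w i) (λ k → ∣M∣≤B b k j))
    where
    X = (d ℕ.* B) ℕ.^ length w
    reassoc : ∀ d B X → d ℕ.* (X ℕ.* B) ≡ d ℕ.* B ℕ.* X
    reassoc = solve-∀

  regular-growth : ∀ {s} → Regular2 s → ∃[ C ] ∃[ K ] ∀ n → ∣ s n ∣ ≤ toℚ (C ℕ.* K ℕ.^ length (rep2 n))
  regular-growth {s} R = d ℕ.* (BV ℕ.* (d ℕ.* BW)) , d ℕ.* B , λ n →
    subst₂ (λ x n → ∣ x ∣ ≤ toℚ n) (sym (trans (rep n) (bilinear≡∙*ᵛ d V (P n) W))) (reassoc d BV BW (X n))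
      (∣∙∣≤ V (P n *ᵛ W) {BV} {d ℕ.* (X n ℕ.* BW)} ∣V∣≤BV
        (λ i → ∣∙∣≤ (P n i) W {X n} {BW} (∣prodWord∣≤ d M B ∣M∣≤B (rep2 n) i) ∣W∣≤BW))
    where
    open Regular2 R renaming (dim to d)
    P = λ n → prodWord d M (rep2 n)
    BV = proj₁ (vector-bound V)
    ∣V∣≤BV = proj₂ (vector-bound V)
    BW = proj₁ (vector-bound W)
    ∣W∣≤BW = proj₂ (vector-bound W)
    BM = λ b → proj₁ (matrix-bound (M b))
    B = BM false ⊔ BM true
    X = λ n → (d ℕ.* B) ℕ.^ length (rep2 n)
    ∣M∣≤B : ∀ b i j → ∣ M b i j ∣ ≤ toℚ B
    ∣M∣≤B false i j = ≤-trans (proj₂ (matrix-bound (M false)) i j) (toℚ-mono-≤ (ℕ.m≤m⊔n (BM false) (BM true)))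
    ∣M∣≤B true  i j = ≤-trans (proj₂ (matrix-bound (M true)) i j) (toℚ-mono-≤ (ℕ.m≤n⊔m (BM false) (BM true)))
    reassoc : ∀ d a b X → d ℕ.* (a ℕ.* (d ℕ.* (X ℕ.* b))) ≡ d ℕ.* (a ℕ.* (d ℕ.* b)) ℕ.* X
    reassoc = solve-∀

  ℕ-regular-growth : ∀ {f : ℕ → ℕ} → Regular2 (λ n → toℚ (f n)) →
                     ∃[ C ] ∃[ K ] ∀ n → f n ℕ.≤ C ℕ.* K ℕ.^ length (rep2 n)
  ℕ-regular-growth {f} R with regular-growth R
  ... | C , K , growth = C , K , λ n →
    toℚ-cancel-≤ (subst (_≤ toℚ (C ℕ.* K ℕ.^ length (rep2 n))) (0≤p⇒∣p∣≡p (toℚ-mono-≤ {0} {f n} z≤n)) (growth n))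


module Arithmetic where

  open import Data.Nat
  open import Data.Nat.Properties
  open import Data.Nat.Tactic.RingSolver using (solve-∀)
  open import Data.Product using (∃-syntax; _,_)
  open import Relation.Binary.PropositionalEquality
  open ≤-Reasoning

  n<2^n : ∀ n → n < 2 ^ n
  n<2^n zero    = s≤s z≤n
  n<2^n (suc n) = begin
    2 + n              ≡⟨ cong suc (+-comm 1 n) ⟩
    suc n + 1          ≤⟨ +-mono-≤ (n<2^n n) (m^n>0 2 n) ⟩
    2 ^ n + 2 ^ n      ≡⟨ cong (2 ^ n +_) (+-identityʳ (2 ^ n)) ⟨
    2 ^ suc n          ∎

  linear<exponential : ∀ A → A * suc (suc (A + A) + suc (A + A)) < 2 ^ (suc (A + A) + suc (A + A))
  linear<exponential A = begin-strict
    A * suc (q + q)                   <⟨ m<m+n (A * suc (q + q)) (s≤s z≤n) ⟩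
    A * suc (q + q) + suc (5 * A + 3) ≡⟨ square A ⟩
    suc q * suc q                     ≤⟨ *-mono-≤ (n<2^n q) (n<2^n q) ⟩
    2 ^ q * 2 ^ q                     ≡⟨ ^-distribˡ-+-* 2 q q ⟨
    2 ^ (q + q)                       ∎
    where
    q = suc (A + A)
    square : ∀ A → A * suc (suc (A + A) + suc (A + A)) + suc (5 * A + 3) ≡ suc (suc (A + A)) * suc (suc (A + A))
    square = solve-∀

  geometric<doubleExponential : ∀ C K → ∃[ p ] C * K ^ p < 2 ^ 2 ^ p
  geometric<doubleExponential C K = p , (begin-strict
    C * K ^ p                ≤⟨ *-mono-≤ (<⇒≤ C<2^A) (^-monoˡ-≤ p (<⇒≤ K<2^A)) ⟩
    2 ^ A * (2 ^ A) ^ p      ≡⟨ cong (2 ^ A *_) (^-*-assoc 2 A p) ⟩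
    2 ^ A * 2 ^ (A * p)      ≡⟨ ^-distribˡ-+-* 2 A (A * p) ⟨
    2 ^ (A + A * p)          ≡⟨ cong (2 ^_) (*-suc A p) ⟨
    2 ^ (A * suc p)          <⟨ ^-monoʳ-< 2 ≤-refl (linear<exponential A) ⟩
    2 ^ 2 ^ p                ∎)
    where
    A = C + K
    p = suc (A + A) + suc (A + A)
    C<2^A : C < 2 ^ A
    C<2^A = <-≤-trans (n<2^n C) (^-monoʳ-≤ 2 (m≤m+n C K))
    K<2^A : K < 2 ^ A
    K<2^A = <-≤-trans (n<2^n K) (^-monoʳ-≤ 2 (m≤n+m K C))


open import Data.Bool using (true; false; if_then_else_)
open import Data.List using (_∷_; _++_; [_]; replicate; length)
open import Data.Nat using (ℕ; zero; suc; _+_; _*_; _^_; _<_)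
open import Data.Nat.Properties using (<-irrefl; *-comm; *-assoc; ^-distribˡ-+-*; module ≤-Reasoning)
open import Data.Rational using (0ℚ)
open import Data.Rational.Properties using (1≢0)
open import Data.Vec.Functional using (Vector)
open import Relation.Binary.PropositionalEquality using (_≡_; _≢_; refl; cong; module ≡-Reasoning)
open Binary
open Language
open LinearAlgebra
open RegularSequences
open Growth
open Arithmetic

v-not-regular : ¬ Regular2 (λ n → toℚ (v n))
v-not-regular R = no-infinite-triangular-family a b diagonal upper
  where
  open ≡-Reasoning
  open Regular2 R renaming (dim to d)

  -- Words are listed least significant digit first: the word in a i reads 1 0^(2^i), the one in
  -- b j reads 0^(2^j + 1).
  a b : ℕ → Vector _ d
  a i = V ᵛ* prodWord d M (replicate (2 ^ i) false ++ [ true ])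
  b j = wordAction M (replicate (suc (2 ^ j)) false) W

  replicate-+ : ∀ {A : Set} m n (x : A) → replicate (m + n) x ≡ replicate m x ++ replicate n x
  replicate-+ zero    n x = refl
  replicate-+ (suc m) n x = cong (x ∷_) (replicate-+ m n x)

  a∙b : ∀ i j → a i ∙ b j ≡ toℚ (if thueMorse (2 ^ j + 2 ^ i) then 1 else 0)
  a∙b i j = begin
    a i ∙ b j
      ≡⟨ regular-split R (replicate (suc (2 ^ j)) false) (replicate (2 ^ i) false) ⟨
    toℚ (v (val ((replicate (suc (2 ^ j)) false ++ replicate (2 ^ i) false) ++ [ true ])))
      ≡⟨ cong (λ w → toℚ (v (val (w ++ [ true ])))) (replicate-+ (suc (2 ^ j)) (2 ^ i) false) ⟨
    toℚ (v (val (replicate (suc (2 ^ j + 2 ^ i)) false ++ [ true ])))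
      ≡⟨ cong toℚ (v-zeros-true (2 ^ j + 2 ^ i)) ⟩
    toℚ (if thueMorse (2 ^ j + 2 ^ i) then 1 else 0) ∎

  diagonal : ∀ i → a i ∙ b i ≢ 0ℚ
  diagonal i rewrite a∙b i i | thueMorse-2^+2^-diagonal i = 1≢0

  upper : ∀ {i j} → i < j → a i ∙ b j ≡ 0ℚ
  upper {i} {j} i<j rewrite a∙b i j | thueMorse-2^+2^ i<j = refl

u-not-regular : ¬ Regular2 (λ n → toℚ (u n))
u-not-regular R with ℕ-regular-growth {u} R
... | C , K , growth with geometric<doubleExponential (C * K ^ 2) K
... | p , C′K^p<2^2^p = <-irrefl refl (begin-strict
  2 ^ 2 ^ p                            ≤⟨ u-lower (2 ^ p) ⟩
  u (2 ^ p * 2)                        ≡⟨ cong u (*-comm (2 ^ p) 2) ⟩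
  u (2 ^ suc p)                        ≤⟨ growth (2 ^ suc p) ⟩
  C * K ^ length (rep2 (2 ^ suc p))    ≡⟨ cong (λ l → C * K ^ l) (length-rep2-2^ (suc p)) ⟩
  C * K ^ (2 + p)                      ≡⟨ cong (C *_) (^-distribˡ-+-* K 2 p) ⟩
  C * (K ^ 2 * K ^ p)                  ≡⟨ *-assoc C (K ^ 2) (K ^ p) ⟨
  C * K ^ 2 * K ^ p                    <⟨ C′K^p<2^2^p ⟩
  2 ^ 2 ^ p                            ∎)
  where open ≤-Reasoning

proposition5 : (¬ Regular2 (λ n → toℚ (u n))) × (¬ Regular2 (λ n → toℚ (v n)))
proposition5 = u-not-regular , v-not-regular
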